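{- Let $G=(V,E)$ be a connected undirected graph and let $X_1,\dots,X_k$ be pairwise disjoint subsets of $V$ such that $G\setminus X_i$ is connected for every $i\in\{1,\dots,k\}$. Let $u,v$ be two vertices of $G$ not belonging to any of $X_1,\dots,X_k$, and suppose that $u$ and $v$ belong to the same $2$-edge-connected component of $G\setminus X_i$ for every $i\in\{1,\dots,k\}$. Let $G'$ be the graph obtained from $G$ by contracting every $X_i$ into a single marked vertex. Then $u$ and $v$ belong to the same marked vertex-edge block of $G'$.
   Context: For an undirected graph $G'$ with a set $V'$ of marked vertices, a marked vertex-edge block is a maximal subset $B\subseteq V(G')\setminus V'$ such that all vertices of $B$ remain in the same connected component of $G'\setminus\{w,e\}$ for every marked vertex $w$ and every edge $e$. -}

module Defs where

open import Data.Nat using (ℕ; zero; suc)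
open import Data.Fin using (Fin; zero; suc)
open import Data.Fin.Subset using (Subset; _∈_; _∉_)
open import Data.Fin.Subset.Properties using (_∈?_)
open import Data.Maybe using (Maybe; just; nothing)
import Data.Maybe as Maybe
open import Data.Product using (Σ; _×_; _,_; proj₁; proj₂)
open import Data.Sum using (_⊎_; inj₁; inj₂)
open import Data.Unit using (⊤)
open import Relation.Nullary using (¬_; yes; no)
open import Relation.Binary.PropositionalEquality using (_≡_; refl)

-- Finite undirected multigraphs: vertices Fin n, edges indexed by Fin m,
-- each edge given by its (unordered) pair of endpoints.

record Graph : Set where
  field
    n    : ℕ
    m    : ℕ
    ends : Fin m → Fin n × Fin n
open Graph public

Joins : {V : Set} → V × V → V → V → Set
Joins (a , b) x y = (a ≡ x × b ≡ y) ⊎ (a ≡ y × b ≡ x)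

-- Reachability in the subgraph of a multigraph (vertex type V, edges Fin m
-- with endpoint map ends) keeping only the vertices satisfying okV and the
-- edges satisfying okE.  (An edge can only be used if both endpoints are kept.)
data Reach {V : Set} {m : ℕ} (ends : Fin m → V × V)
           (okV : V → Set) (okE : Fin m → Set) : V → V → Set where
  here : ∀ {x} → okV x → Reach ends okV okE x x
  step : ∀ {x y z} (e : Fin m) → okE e → okV x → Joins (ends e) x y →
         Reach ends okV okE y z → Reach ends okV okE x z

Connected : Graph → Set
Connected G = ∀ x y → Reach (ends G) (λ _ → ⊤) (λ _ → ⊤) x y

ConnectedWithout : (G : Graph) → Subset (n G) → Set
ConnectedWithout G X =
  ∀ x y → x ∉ X → y ∉ X → Reach (ends G) (λ z → z ∉ X) (λ _ → ⊤) x y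

Same2ECCWithout : (G : Graph) → Subset (n G) → Fin (n G) → Fin (n G) → Set
Same2ECCWithout G X u v =
  u ∉ X × v ∉ X ×
  (∀ (e : Fin (m G)) → Reach (ends G) (λ z → z ∉ X) (λ f → ¬ f ≡ e) u v)

owner : ∀ {n} k → (Fin k → Subset n) → Fin n → Maybe (Fin k)
owner zero    X x = nothing
owner (suc k) X x with x ∈? X zero
... | yes _ = just zero
... | no  _ = Maybe.map suc (owner k (λ i → X (suc i)) x)

-- vertices of the contracted graph: the unaffected vertices of G, plus one
-- (marked) vertex per set X i
CVertex : ∀ {n} k → (Fin k → Subset n) → Set
CVertex {n} k X = (Σ (Fin n) λ x → owner k X x ≡ nothing) ⊎ Fin k

Marked : ∀ {n} k (X : Fin k → Subset n) → CVertex k X → Set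
Marked k X (inj₁ _) = Data.Empty.⊥ where import Data.Empty
Marked k X (inj₂ _) = ⊤

contractAux : ∀ {n} k (X : Fin k → Subset n) (x : Fin n) (o : Maybe (Fin k)) →
              owner k X x ≡ o → CVertex k X
contractAux k X x nothing  eq = inj₁ (x , eq)
contractAux k X x (just i) eq = inj₂ i

contractV : ∀ {n} k (X : Fin k → Subset n) → Fin n → CVertex k X
contractV k X x = contractAux k X x (owner k X x) refl

-- endpoint map of the contracted multigraph G' (same edge set as G; edges
-- inside some X i become loops, parallel edges are kept)
contractEnds : (G : Graph) (k : ℕ) (X : Fin k → Subset (n G)) →
               Fin (m G) → CVertex k X × CVertex k X
contractEnds G k X e = contractV k X (proj₁ (ends G e)) , contractV k X (proj₂ (ends G e))

StaysTogether : {V : Set} {m : ℕ} (ends : Fin m → V × V) (Mk : V → Set) →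
                (V → Set) → Set
StaysTogether {V} {m} ends Mk B =
  ∀ x y → B x → B y → ∀ (w : V) → Mk w → ∀ (e : Fin m) →
  Reach ends (λ z → ¬ z ≡ w) (λ f → ¬ f ≡ e) x y

IsMVEBlock : {V : Set} {m : ℕ} (ends : Fin m → V × V) (Mk : V → Set) →
             (V → Set) → Set₁
IsMVEBlock {V} ends Mk B =
  (∀ x → B x → ¬ Mk x) ×
  StaysTogether ends Mk B ×
  (∀ (B' : V → Set) → (∀ x → B x → B' x) → (∀ x → B' x → ¬ Mk x) →
     StaysTogether ends Mk B' → ∀ x → B' x → B x)

SameMVEBlock : {V : Set} {m : ℕ} (ends : Fin m → V × V) (Mk : V → Set) →
               V → V → Set₁
SameMVEBlock {V} ends Mk u v = Σ (V → Set) λ B → IsMVEBlock ends Mk B × B u × B v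

{-# OPTIONS --safe #-}
module Submission where

-- Since every Xᵢ avoids u and v, the contraction maps each u–v path of G \ Xᵢ
-- avoiding an edge e to a u–v path of G' avoiding the marked vertex of Xᵢ and e.
-- The set of unmarked vertices reachable from u in every G' \ {w, e} is a marked
-- vertex-edge block, and v belongs to it.

open import Defs
open import Data.Nat using (ℕ; suc)
open import Data.Fin using (Fin; zero; suc)
open import Data.Fin.Subset using (Subset; _∈_; _∉_)
open import Data.Fin.Subset.Properties using (_∈?_)
open import Data.Maybe using (just)
open import Data.Product using (_×_; _,_; proj₁; proj₂)
open import Data.Sum using (inj₁; inj₂)
open import Function using (_∘_)
open import Relation.Nullary using (¬_; yes; no)
open import Relation.Binary.PropositionalEquality using (_≡_; refl)

Joins-sym : ∀ {V : Set} {p : V × V} {x y} → Joins p x y → Joins p y x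
Joins-sym (inj₁ eqs) = inj₂ eqs
Joins-sym (inj₂ eqs) = inj₁ eqs

Joins-map : ∀ {V W : Set} (f : V → W) {a b x y : V} →
            Joins (a , b) x y → Joins (f a , f b) (f x) (f y)
Joins-map f (inj₁ (refl , refl)) = inj₁ (refl , refl)
Joins-map f (inj₂ (refl , refl)) = inj₂ (refl , refl)

module _ {V : Set} {m : ℕ} {ends : Fin m → V × V}
         {okV : V → Set} {okE : Fin m → Set} where

  Reach-source : ∀ {x y} → Reach ends okV okE x y → okV x
  Reach-source (here ok) = ok
  Reach-source (step _ _ ok _ _) = ok

  Reach-trans : ∀ {x y z} → Reach ends okV okE x y → Reach ends okV okE y z →
                Reach ends okV okE x z
  Reach-trans (here _) q = q
  Reach-trans (step e okE-e okV-x j p) q = step e okE-e okV-x j (Reach-trans p q)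

  Reach-sym : ∀ {x y} → Reach ends okV okE x y → Reach ends okV okE y x
  Reach-sym (here ok) = here ok
  Reach-sym (step e okE-e okV-x j p) =
    Reach-trans (Reach-sym p) (step e okE-e (Reach-source p) (Joins-sym j) (here okV-x))

Reach-map : ∀ {V W : Set} {m} {ends : Fin m → V × V} {ends' : Fin m → W × W}
            {okV : V → Set} {okV' : W → Set} {okE okE' : Fin m → Set} (f : V → W) →
            (∀ e {x y} → Joins (ends e) x y → Joins (ends' e) (f x) (f y)) →
            (∀ {x} → okV x → okV' (f x)) → (∀ {e} → okE e → okE' e) →
            ∀ {x y} → Reach ends okV okE x y → Reach ends' okV' okE' (f x) (f y)
Reach-map f joins okV⇒ okE⇒ (here ok) = here (okV⇒ ok)
Reach-map f joins okV⇒ okE⇒ (step e okE-e okV-x j p) =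
  step e (okE⇒ okE-e) (okV⇒ okV-x) (joins e j) (Reach-map f joins okV⇒ okE⇒ p)

Avoiding : ∀ {V : Set} {m} → (Fin m → V × V) → V → Fin m → V → V → Set
Avoiding ends w e = Reach ends (λ z → ¬ z ≡ w) (λ f → ¬ f ≡ e)

module _ {V : Set} {m : ℕ} (ends : Fin m → V × V) (Mk : V → Set) where

  BlockOf : V → V → Set
  BlockOf c x = ¬ Mk x × (∀ w → Mk w → ∀ e → Avoiding ends w e c x)

  BlockOf-self : ∀ {c} → ¬ Mk c → BlockOf c c
  BlockOf-self ¬Mk-c = ¬Mk-c , λ w Mk-w e → here λ { refl → ¬Mk-c Mk-w }

  BlockOf-isMVEBlock : ∀ {c} → ¬ Mk c → IsMVEBlock ends Mk (BlockOf c)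
  BlockOf-isMVEBlock {c} ¬Mk-c = (λ _ → proj₁) , together , maximal
    where
    together : StaysTogether ends Mk (BlockOf c)
    together x y (_ , c⇝x) (_ , c⇝y) w Mk-w e =
      Reach-trans (Reach-sym (c⇝x w Mk-w e)) (c⇝y w Mk-w e)

    maximal : ∀ B → (∀ x → BlockOf c x → B x) → (∀ x → B x → ¬ Mk x) →
              StaysTogether ends Mk B → ∀ x → B x → BlockOf c x
    maximal B ⊇ unmarked together' x Bx =
      unmarked x Bx , together' c x (⊇ c (BlockOf-self ¬Mk-c)) Bx

  sameMVEBlock : ∀ {x y} → ¬ Mk x → ¬ Mk y → (∀ w → Mk w → ∀ e → Avoiding ends w e x y) →
                 SameMVEBlock ends Mk x y
  sameMVEBlock ¬Mk-x ¬Mk-y x⇝y =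
    BlockOf _ , BlockOf-isMVEBlock ¬Mk-x , BlockOf-self ¬Mk-x , (¬Mk-y , x⇝y)

owner-∈ : ∀ {n} k (X : Fin k → Subset n) {x i} → owner k X x ≡ just i → x ∈ X i
owner-∈ (suc k) X {x} eq with x ∈? X zero
owner-∈ (suc k) X {x} refl | yes x∈X₀ = x∈X₀
owner-∈ (suc k) X {x} eq   | no _ with owner k (X ∘ suc) x in eq'
owner-∈ (suc k) X {x} refl | no _ | just i = owner-∈ k (X ∘ suc) eq'

contractV-∈ : ∀ {n} k (X : Fin k → Subset n) {x i} → contractV k X x ≡ inj₂ i → x ∈ X i
contractV-∈ k X {x} = go (owner k X x) refl
  where
  go : ∀ {i} o (eq : owner k X x ≡ o) → contractAux k X x o eq ≡ inj₂ i → x ∈ X i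
  go (just _) eq refl = owner-∈ k X eq

contractV-unmarked : ∀ {n} k (X : Fin k → Subset n) {x} → (∀ i → x ∉ X i) →
                     ¬ Marked k X (contractV k X x)
contractV-unmarked k X {x} x∉X Mk-x with contractV k X x in eq
... | inj₂ i = x∉X i (contractV-∈ k X eq)

contract-Reach : (G : Graph) (k : ℕ) (X : Fin k → Subset (n G)) (i : Fin k) (e : Fin (m G)) →
                 ∀ {x y} → Reach (ends G) (λ z → z ∉ X i) (λ f → ¬ f ≡ e) x y →
                 Avoiding (contractEnds G k X) (inj₂ i) e (contractV k X x) (contractV k X y)
contract-Reach G k X i e =
  Reach-map (contractV k X) (λ _ → Joins-map (contractV k X))
            (λ x∉Xᵢ → x∉Xᵢ ∘ contractV-∈ k X) (λ f≢e → f≢e)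

lemma22 : (G : Graph) (k : ℕ) (X : Fin k → Subset (n G)) →
    Connected G →
    (∀ i j → ¬ i ≡ j → ∀ x → x ∈ X i → x ∉ X j) →
    (∀ i → ConnectedWithout G (X i)) →
    (u v : Fin (n G)) →
    (∀ i → u ∉ X i) → (∀ i → v ∉ X i) →
    (∀ i → Same2ECCWithout G (X i) u v) →
    SameMVEBlock (contractEnds G k X) (Marked k X) (contractV k X u) (contractV k X v)
lemma22 G k X _ _ _ u v u∉X v∉X same =
  sameMVEBlock (contractEnds G k X) (Marked k X)
    (contractV-unmarked k X u∉X) (contractV-unmarked k X v∉X) u⇝v
  where
  u⇝v : ∀ w → Marked k X w → ∀ e →
        Avoiding (contractEnds G k X) w e (contractV k X u) (contractV k X v)
  u⇝v (inj₂ i) _ e = contract-Reach G k X i e (proj₂ (proj₂ (same i)) e)
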